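{- For all $N,M\in\mathbb{Z}_{\ge0}$, $$\begin{bmatrix}2N+2M+1\\ 2N\end{bmatrix}_{\sqrt q}=\sum_{i=0}^{2N}q^{\frac{i}{2}}\begin{bmatrix}i+M\\ i\end{bmatrix}_q\begin{bmatrix}M+2N-i\\ M\end{bmatrix}_q.$$
   Context: $(x;p)_j=\prod_{i=0}^{j-1}(1-xp^i)$. For a base $p$ and integers $N,j$: $\begin{bmatrix}N\\ j\end{bmatrix}_p=\frac{(p^{N-j+1};p)_j}{(p;p)_j}$ if $j\ge0$ and $0$ otherwise; the base $\sqrt q$ means $p=q^{1/2}$. -}

module Defs where

open import Data.Nat as ℕ using (ℕ; zero; suc; _∸_; _≤?_)
open import Data.Rational using (ℚ; 0ℚ; 1ℚ; _+_; _*_; _-_; _÷_; ≢-nonZero)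
open import Data.Rational.Properties using (_≟_)
open import Relation.Nullary using (yes; no)

pow : ℚ → ℕ → ℚ
pow p zero    = 1ℚ
pow p (suc n) = p * pow p n

poch : ℚ → ℚ → ℕ → ℚ
poch x p zero    = 1ℚ
poch x p (suc j) = poch x p j * (1ℚ - x * pow p j)

-- division in ℚ, used only where the denominator is provably nonzero
-- (the value at a zero denominator is irrelevant and set to 0)
divℚ : ℚ → ℚ → ℚ
divℚ x y with y ≟ 0ℚ
... | yes _  = 0ℚ
... | no y≢0 = _÷_ x y {{≢-nonZero y≢0}}

-- For natural N < j the numerator contains the factor (1 - p^0) = 0, so the
-- value is 0; we return 0 directly in that case (natural subtraction would
-- otherwise truncate N - j + 1).
qbinom : ℚ → ℕ → ℕ → ℚ
qbinom p N j with j ≤? N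
... | yes _ = divℚ (poch (pow p (suc (N ∸ j))) p j) (poch p p j)
... | no _  = 0ℚ

sumUpTo : ℕ → (ℕ → ℚ) → ℚ
sumUpTo zero    f = f 0
sumUpTo (suc n) f = sumUpTo n f + f (suc n)

-- Writing q = p², the Pochhammer symbol in base p splits into its even and odd factors,
-- (x;p)_{2K} = (x;q)_K (px;q)_K.  Hence 1/(x;p)_{2M+2} is the product of 1/(px;q)_{M+1}
-- and 1/(x;q)_{M+1}, and the identity is the comparison of the coefficients of x^{2N}
-- on both sides, once we know (q-binomial theorem) that the coefficient of x^k in
-- 1/(cx;p)_{K+1} is c^k [k+K, k]_p.  Power series are handled through their coefficient
-- sequences; two series agree as soon as they agree after multiplication by a factor
-- (1 − a x), because that multiplication is injective on coefficient sequences.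
module Submission where

open import Defs
open import Data.Nat as ℕ using (ℕ; zero; suc; _∸_)
import Data.Nat.Properties as ℕₚ
open import Data.Rational
  using (ℚ; 0ℚ; 1ℚ; -_; _+_; _*_; _-_; 1/_; ∣_∣; _≤_; NonNegative; ≢-nonZero)
import Data.Rational.Properties as ℚₚ
open import Data.Rational.Solver using (module +-*-Solver)
open +-*-Solver using (solve; _:+_; _:-_; _:*_; _:=_; con)
open import Algebra.Apartness.Properties.HeytingCommutativeRing ℚₚ.heytingCommutativeRing
  using (x#0y#0→xy#0)
open import Data.Sum using (inj₁; inj₂)
open import Function using (_∘_)
open import Relation.Binary.Definitions using (tri<; tri≈; tri>)
open import Relation.Binary.PropositionalEquality
open import Relation.Nullary using (yes; no; contradiction)

sumUpTo-cong : ∀ n {f g : ℕ → ℚ} → (∀ i → i ℕ.≤ n → f i ≡ g i) → sumUpTo n f ≡ sumUpTo n g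
sumUpTo-cong zero    f≡g = f≡g 0 ℕ.z≤n
sumUpTo-cong (suc n) f≡g =
  cong₂ _+_ (sumUpTo-cong n (λ i i≤n → f≡g i (ℕₚ.m≤n⇒m≤1+n i≤n))) (f≡g (suc n) ℕₚ.≤-refl)

sumUpTo-zero : ∀ n {f : ℕ → ℚ} → (∀ i → f i ≡ 0ℚ) → sumUpTo n f ≡ 0ℚ
sumUpTo-zero zero    f≡0 = f≡0 0
sumUpTo-zero (suc n) f≡0 = cong₂ _+_ (sumUpTo-zero n f≡0) (f≡0 (suc n))

sumUpTo-suc-head : ∀ n (f : ℕ → ℚ) → sumUpTo (suc n) f ≡ f 0 + sumUpTo n (f ∘ suc)
sumUpTo-suc-head zero    f = refl
sumUpTo-suc-head (suc n) f = trans (cong (_+ f (suc (suc n))) (sumUpTo-suc-head n f))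
  (ℚₚ.+-assoc (f 0) (sumUpTo n (f ∘ suc)) (f (suc (suc n))))

sumUpTo-linear : ∀ n a (f g : ℕ → ℚ) →
  sumUpTo n (λ i → f i - a * g i) ≡ sumUpTo n f - a * sumUpTo n g
sumUpTo-linear zero    a f g = refl
sumUpTo-linear (suc n) a f g rewrite sumUpTo-linear n a f g =
  solve 5 (λ a F G x y → (F :- a :* G) :+ (x :- a :* y) := (F :+ x) :- a :* (G :+ y)) refl
    a (sumUpTo n f) (sumUpTo n g) (f (suc n)) (g (suc n))

sumUpTo-reverse : ∀ n (f : ℕ → ℚ) → sumUpTo n (λ i → f (n ∸ i)) ≡ sumUpTo n f
sumUpTo-reverse zero    f = refl
sumUpTo-reverse (suc n) f = begin
    sumUpTo n (λ i → f (suc n ∸ i)) + f (suc n ∸ suc n)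
  ≡⟨ cong₂ _+_ (sumUpTo-cong n (λ i i≤n → cong f (ℕₚ.+-∸-assoc 1 i≤n))) (cong f (ℕₚ.n∸n≡0 n)) ⟩
    sumUpTo n (λ i → f (suc (n ∸ i))) + f 0
  ≡⟨ cong (_+ f 0) (sumUpTo-reverse n (f ∘ suc)) ⟩
    sumUpTo n (f ∘ suc) + f 0
  ≡⟨ ℚₚ.+-comm (sumUpTo n (f ∘ suc)) (f 0) ⟩
    f 0 + sumUpTo n (f ∘ suc)
  ≡⟨ sumUpTo-suc-head n f ⟨
    sumUpTo (suc n) f ∎
  where open ≡-Reasoning

-- Formal power series as coefficient sequences

conv : (ℕ → ℚ) → (ℕ → ℚ) → ℕ → ℚ
conv f g k = sumUpTo k (λ i → f i * g (k ∸ i))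

δ : ℕ → ℚ
δ zero    = 1ℚ
δ (suc k) = 0ℚ

-- coefficients of (1 − a x) · f(x)
mulOneMinus : ℚ → (ℕ → ℚ) → ℕ → ℚ
mulOneMinus a f zero    = f zero
mulOneMinus a f (suc k) = f (suc k) - a * f k

conv-cong : ∀ {f f′ g g′} → f ≗ f′ → g ≗ g′ → conv f g ≗ conv f′ g′
conv-cong f≗f′ g≗g′ k = sumUpTo-cong k (λ i _ → cong₂ _*_ (f≗f′ i) (g≗g′ (k ∸ i)))

conv-comm : ∀ f g → conv f g ≗ conv g f
conv-comm f g k = begin
    sumUpTo k (λ i → f i * g (k ∸ i))
  ≡⟨ sumUpTo-reverse k (λ i → f i * g (k ∸ i)) ⟨
    sumUpTo k (λ i → f (k ∸ i) * g (k ∸ (k ∸ i)))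
  ≡⟨ sumUpTo-cong k (λ i i≤k → trans (cong (λ j → f (k ∸ i) * g j) (ℕₚ.m∸[m∸n]≡n i≤k))
                                      (ℚₚ.*-comm (f (k ∸ i)) (g i))) ⟩
    sumUpTo k (λ i → g i * f (k ∸ i)) ∎
  where open ≡-Reasoning

conv-identityˡ : ∀ g → conv δ g ≗ g
conv-identityˡ g zero    = ℚₚ.*-identityˡ (g 0)
conv-identityˡ g (suc k) = begin
    conv δ g (suc k)
  ≡⟨ sumUpTo-suc-head k (λ i → δ i * g (suc k ∸ i)) ⟩
    1ℚ * g (suc k) + sumUpTo k (λ i → 0ℚ * g (k ∸ i))
  ≡⟨ cong₂ _+_ (ℚₚ.*-identityˡ (g (suc k))) (sumUpTo-zero k (λ i → ℚₚ.*-zeroˡ (g (k ∸ i)))) ⟩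
    g (suc k) + 0ℚ
  ≡⟨ ℚₚ.+-identityʳ (g (suc k)) ⟩
    g (suc k) ∎
  where open ≡-Reasoning

mulOneMinus-cong : ∀ {a b f g} → a ≡ b → f ≗ g → mulOneMinus a f ≗ mulOneMinus b g
mulOneMinus-cong refl f≗g zero    = f≗g 0
mulOneMinus-cong {a} refl f≗g (suc k) = cong₂ (λ x y → x - a * y) (f≗g (suc k)) (f≗g k)

mulOneMinus-convˡ : ∀ a f g → mulOneMinus a (conv f g) ≗ conv (mulOneMinus a f) g
mulOneMinus-convˡ a f g zero    = refl
mulOneMinus-convˡ a f g (suc k) = begin
    conv f g (suc k) - a * conv f g k
  ≡⟨ cong (_- a * conv f g k) (sumUpTo-suc-head k (λ i → f i * g (suc k ∸ i))) ⟩
    (f 0 * g (suc k) + S) - a * conv f g k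
  ≡⟨ solve 4 (λ x S a C → (x :+ S) :- a :* C := x :+ (S :- a :* C)) refl
       (f 0 * g (suc k)) S a (conv f g k) ⟩
    f 0 * g (suc k) + (S - a * conv f g k)
  ≡⟨ cong (f 0 * g (suc k) +_) (sumUpTo-linear k a (λ i → f (suc i) * g (k ∸ i)) (λ i → f i * g (k ∸ i))) ⟨
    f 0 * g (suc k) + sumUpTo k (λ i → f (suc i) * g (k ∸ i) - a * (f i * g (k ∸ i)))
  ≡⟨ cong (f 0 * g (suc k) +_) (sumUpTo-cong k (λ i _ →
       solve 4 (λ x y a z → x :* z :- a :* (y :* z) := (x :- a :* y) :* z) refl
         (f (suc i)) (f i) a (g (k ∸ i)))) ⟩
    mulOneMinus a f 0 * g (suc k) + sumUpTo k (λ i → mulOneMinus a f (suc i) * g (k ∸ i))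
  ≡⟨ sumUpTo-suc-head k (λ i → mulOneMinus a f i * g (suc k ∸ i)) ⟨
    conv (mulOneMinus a f) g (suc k) ∎
  where
  open ≡-Reasoning
  S = sumUpTo k (λ i → f (suc i) * g (k ∸ i))

mulOneMinus-convʳ : ∀ a f g → mulOneMinus a (conv f g) ≗ conv f (mulOneMinus a g)
mulOneMinus-convʳ a f g k = begin
    mulOneMinus a (conv f g) k    ≡⟨ mulOneMinus-cong refl (conv-comm f g) k ⟩
    mulOneMinus a (conv g f) k    ≡⟨ mulOneMinus-convˡ a g f k ⟩
    conv (mulOneMinus a g) f k    ≡⟨ conv-comm (mulOneMinus a g) f k ⟩
    conv f (mulOneMinus a g) k    ∎
  where open ≡-Reasoning

mulOneMinus-injective : ∀ a {f g} → mulOneMinus a f ≗ mulOneMinus a g → f ≗ g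
mulOneMinus-injective a {f} {g} eq zero    = eq zero
mulOneMinus-injective a {f} {g} eq (suc k) = begin
    f (suc k)
  ≡⟨ solve 3 (λ x a y → x := (x :- a :* y) :+ a :* y) refl (f (suc k)) a (f k) ⟩
    mulOneMinus a f (suc k) + a * f k
  ≡⟨ cong₂ (λ x y → x + a * y) (eq (suc k)) (mulOneMinus-injective a eq k) ⟩
    mulOneMinus a g (suc k) + a * g k
  ≡⟨ solve 3 (λ x a y → (x :- a :* y) :+ a :* y := x) refl (g (suc k)) a (g k) ⟩
    g (suc k) ∎
  where open ≡-Reasoning

-- coefficient of x^k in 1/(cx;p)_K
invPochCoeff : ℚ → ℚ → ℕ → ℕ → ℚ
invPochCoeff c p zero          = δ
invPochCoeff c p (suc K) zero    = 1ℚ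
invPochCoeff c p (suc K) (suc k) =
  invPochCoeff c p K (suc k) + c * pow p K * invPochCoeff c p (suc K) k

mulOneMinus-invPochCoeff : ∀ c p K →
  mulOneMinus (c * pow p K) (invPochCoeff c p (suc K)) ≗ invPochCoeff c p K
mulOneMinus-invPochCoeff c p zero    zero    = refl
mulOneMinus-invPochCoeff c p (suc K) zero    = refl
mulOneMinus-invPochCoeff c p K       (suc k) =
  solve 2 (λ x y → (x :+ y) :- y := x) refl
    (invPochCoeff c p K (suc k)) (c * pow p K * invPochCoeff c p (suc K) k)

invPochCoeff-scale : ∀ c p K k → invPochCoeff c p K k ≡ pow c k * invPochCoeff 1ℚ p K k
invPochCoeff-scale c p zero    zero    = refl
invPochCoeff-scale c p zero    (suc k) = sym (ℚₚ.*-zeroʳ (pow c (suc k)))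
invPochCoeff-scale c p (suc K) zero    = refl
invPochCoeff-scale c p (suc K) (suc k)
  rewrite invPochCoeff-scale c p K (suc k) | invPochCoeff-scale c p (suc K) k =
  solve 5 (λ c C P A B → c :* C :* A :+ c :* P :* (C :* B) := c :* C :* (A :+ con 1ℚ :* P :* B))
    refl c (pow c k) (pow p K) (invPochCoeff 1ℚ p K (suc k)) (invPochCoeff 1ℚ p (suc K) k)

pow-+ : ∀ p m n → pow p (m ℕ.+ n) ≡ pow p m * pow p n
pow-+ p zero    n = sym (ℚₚ.*-identityˡ (pow p n))
pow-+ p (suc m) n = trans (cong (p *_) (pow-+ p m n)) (sym (ℚₚ.*-assoc p (pow p m) (pow p n)))

pow-square : ∀ p n → pow (p * p) n ≡ pow p (n ℕ.+ n)
pow-square p zero    = refl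
pow-square p (suc n) rewrite ℕₚ.+-suc n n | pow-square p n = ℚₚ.*-assoc p p (pow p (n ℕ.+ n))

-- Both sides become 1/(x;p)_{2K} after multiplication by (1 − p^{2K+1} x)(1 − p^{2K} x).
conv-invPochCoeff-square : ∀ p K →
  conv (invPochCoeff p (p * p) K) (invPochCoeff 1ℚ (p * p) K) ≗ invPochCoeff 1ℚ p (K ℕ.+ K)
conv-invPochCoeff-square p zero    = conv-identityˡ δ
conv-invPochCoeff-square p (suc K) =
  subst (λ n → conv F G ≗ invPochCoeff 1ℚ p n) (cong suc (sym (ℕₚ.+-suc K K)))
    (mulOneMinus-injective odd (mulOneMinus-injective even λ k → trans (lhs k) (sym (rhs k))))
  where
  q = p * p
  F = invPochCoeff p q (suc K)
  G = invPochCoeff 1ℚ q (suc K)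
  odd  = pow p (suc (K ℕ.+ K))
  even = pow p (K ℕ.+ K)
  odd≡ : p * pow q K ≡ odd
  odd≡ = cong (p *_) (pow-square p K)
  even≡ : 1ℚ * pow q K ≡ even
  even≡ = trans (ℚₚ.*-identityˡ (pow q K)) (pow-square p K)
  lhs : mulOneMinus even (mulOneMinus odd (conv F G)) ≗ invPochCoeff 1ℚ p (K ℕ.+ K)
  lhs k = begin
      mulOneMinus even (mulOneMinus odd (conv F G)) k
    ≡⟨ mulOneMinus-cong refl (λ i → trans (mulOneMinus-cong (sym odd≡) (λ _ → refl) i)
                                          (mulOneMinus-convˡ _ F G i)) k ⟩
      mulOneMinus even (conv (mulOneMinus (p * pow q K) F) G) k
    ≡⟨ mulOneMinus-cong refl (conv-cong {g = G} (mulOneMinus-invPochCoeff p q K) (λ _ → refl)) k ⟩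
      mulOneMinus even (conv (invPochCoeff p q K) G) k
    ≡⟨ mulOneMinus-convʳ even (invPochCoeff p q K) G k ⟩
      conv (invPochCoeff p q K) (mulOneMinus even G) k
    ≡⟨ conv-cong {f = invPochCoeff p q K} (λ _ → refl)
         (λ i → trans (mulOneMinus-cong (sym even≡) (λ _ → refl) i) (mulOneMinus-invPochCoeff 1ℚ q K i)) k ⟩
      conv (invPochCoeff p q K) (invPochCoeff 1ℚ q K) k
    ≡⟨ conv-invPochCoeff-square p K k ⟩
      invPochCoeff 1ℚ p (K ℕ.+ K) k ∎
    where open ≡-Reasoning
  rhs : mulOneMinus even (mulOneMinus odd (invPochCoeff 1ℚ p (suc (suc (K ℕ.+ K)))))
          ≗ invPochCoeff 1ℚ p (K ℕ.+ K)
  rhs k = trans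
    (mulOneMinus-cong (sym (ℚₚ.*-identityˡ even))
      (λ i → trans (mulOneMinus-cong (sym (ℚₚ.*-identityˡ odd)) (λ _ → refl) i)
                   (mulOneMinus-invPochCoeff 1ℚ p (suc (K ℕ.+ K)) i)) k)
    (mulOneMinus-invPochCoeff 1ℚ p (K ℕ.+ K) k)

*-cancelʳ-≢0 : ∀ {u v c : ℚ} → c ≢ 0ℚ → u * c ≡ v * c → u ≡ v
*-cancelʳ-≢0 {u} {v} {c} c≢0 eq = begin
    u                ≡⟨ *-*1/-cancel u ⟨
    u * c * 1/ c     ≡⟨ cong (_* 1/ c) eq ⟩
    v * c * 1/ c     ≡⟨ *-*1/-cancel v ⟩
    v                ∎
  where
  open ≡-Reasoning
  instance _ = ≢-nonZero c≢0
  *-*1/-cancel : ∀ w → w * c * 1/ c ≡ w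
  *-*1/-cancel w = trans (ℚₚ.*-assoc w c (1/ c))
                         (trans (cong (w *_) (ℚₚ.*-inverseʳ c)) (ℚₚ.*-identityʳ w))

1-x≢0 : ∀ {x : ℚ} → x ≢ 1ℚ → 1ℚ - x ≢ 0ℚ
1-x≢0 {x} x≢1 1-x≡0 = x≢1 (begin
    x               ≡⟨ solve 1 (λ x → x := con 1ℚ :- (con 1ℚ :- x)) refl x ⟩
    1ℚ - (1ℚ - x)   ≡⟨ cong (λ z → 1ℚ - z) 1-x≡0 ⟩
    1ℚ              ∎)
  where open ≡-Reasoning

module _ (r : ℚ) .{{_ : NonNegative r}} where

  pow-≤-1 : r ≤ 1ℚ → ∀ n → pow r n ≤ 1ℚ
  pow-≤-1 r≤1 zero    = ℚₚ.≤-refl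
  pow-≤-1 r≤1 (suc n) = ℚₚ.≤-trans (ℚₚ.*-monoˡ-≤-nonNeg r (pow-≤-1 r≤1 n))
                                   (subst (_≤ 1ℚ) (sym (ℚₚ.*-identityʳ r)) r≤1)

  1≤pow : 1ℚ ≤ r → ∀ n → 1ℚ ≤ pow r n
  1≤pow 1≤r zero    = ℚₚ.≤-refl
  1≤pow 1≤r (suc n) = ℚₚ.≤-trans (subst (1ℚ ≤_) (sym (ℚₚ.*-identityʳ r)) 1≤r)
                                 (ℚₚ.*-monoˡ-≤-nonNeg r (1≤pow 1≤r n))

  pow-suc-≢1-nonNeg : r ≢ 1ℚ → ∀ m → pow r (suc m) ≢ 1ℚ
  pow-suc-≢1-nonNeg r≢1 m with ℚₚ.<-cmp r 1ℚ
  ... | tri< r<1 _ _ = ℚₚ.<⇒≢ (ℚₚ.≤-<-trans r^[1+m]≤r r<1)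
    where
    r^[1+m]≤r : pow r (suc m) ≤ r
    r^[1+m]≤r = ℚₚ.≤-trans (ℚₚ.*-monoˡ-≤-nonNeg r (pow-≤-1 (ℚₚ.<⇒≤ r<1) m))
                          (ℚₚ.≤-reflexive (ℚₚ.*-identityʳ r))
  ... | tri≈ _ r≡1 _ = contradiction r≡1 r≢1
  ... | tri> _ _ 1<r = ℚₚ.<⇒≢ (ℚₚ.<-≤-trans 1<r r≤r^[1+m]) ∘ sym
    where
    r≤r^[1+m] : r ≤ pow r (suc m)
    r≤r^[1+m] = ℚₚ.≤-trans (ℚₚ.≤-reflexive (sym (ℚₚ.*-identityʳ r)))
                          (ℚₚ.*-monoˡ-≤-nonNeg r (1≤pow (ℚₚ.<⇒≤ 1<r) m))

∣pow∣ : ∀ p n → ∣ pow p n ∣ ≡ pow ∣ p ∣ n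
∣pow∣ p zero    = refl
∣pow∣ p (suc n) = trans (ℚₚ.∣p*q∣≡∣p∣*∣q∣ p (pow p n)) (cong (∣ p ∣ *_) (∣pow∣ p n))

pow-suc-≢1 : ∀ {p} → p ≢ 1ℚ → p ≢ - 1ℚ → ∀ m → pow p (suc m) ≢ 1ℚ
pow-suc-≢1 {p} p≢1 p≢-1 m p^[1+m]≡1 = pow-suc-≢1-nonNeg ∣ p ∣ {{ℚₚ.∣-∣-nonNeg p}} ∣p∣≢1 m
  (trans (sym (∣pow∣ p (suc m))) (cong ∣_∣ p^[1+m]≡1))
  where
  ∣p∣≢1 : ∣ p ∣ ≢ 1ℚ
  ∣p∣≢1 ∣p∣≡1 with ℚₚ.∣p∣≡p∨∣p∣≡-p p
  ... | inj₁ ∣p∣≡p  = p≢1 (trans (sym ∣p∣≡p) ∣p∣≡1)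
  ... | inj₂ ∣p∣≡-p = p≢-1 (ℚₚ.neg-injective (trans (sym ∣p∣≡-p) ∣p∣≡1))

qFactorial : ℚ → ℕ → ℚ
qFactorial p = poch p p

qFactorial-≢0 : ∀ {p} → (∀ m → pow p (suc m) ≢ 1ℚ) → ∀ n → qFactorial p n ≢ 0ℚ
qFactorial-≢0 p^≢1 zero    ()
qFactorial-≢0 p^≢1 (suc n) = x#0y#0→xy#0 (qFactorial-≢0 p^≢1 n) (1-x≢0 (p^≢1 n))

-- Gaussian binomials as coefficients of 1/(x;p)_{K+1}

invPochCoeff-one : ∀ p k → invPochCoeff 1ℚ p 1 k ≡ 1ℚ
invPochCoeff-one p zero = refl
invPochCoeff-one p (suc k) rewrite invPochCoeff-one p k = refl

-- The inductive step is the q-Pascal rule [k+K+1, k+1] = [k+K, k+1] + p^{K+1} [k+K+1, k].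
invPochCoeff-qFactorial : ∀ p K k →
  invPochCoeff 1ℚ p (suc K) k * qFactorial p K * qFactorial p k ≡ qFactorial p (k ℕ.+ K)
invPochCoeff-qFactorial p K       zero    =
  solve 1 (λ x → con 1ℚ :* x :* con 1ℚ := x) refl (qFactorial p K)
invPochCoeff-qFactorial p zero    (suc k) rewrite invPochCoeff-one p (suc k) | ℕₚ.+-identityʳ k =
  solve 2 (λ T y → con 1ℚ :* con 1ℚ :* (T :* y) := T :* y) refl (qFactorial p k) (1ℚ - p * pow p k)
invPochCoeff-qFactorial p (suc K) (suc k) = begin
    (A + 1ℚ * x * B) * (TK * 1-x) * (Tk * 1-y)
  ≡⟨ solve 7 (λ A B x TK Tk u v → (A :+ con 1ℚ :* x :* B) :* (TK :* u) :* (Tk :* v)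
                                 := u :* (A :* TK :* (Tk :* v)) :+ x :* v :* (B :* (TK :* u) :* Tk))
       refl A B x TK Tk 1-x 1-y ⟩
    1-x * (A * TK * qFactorial p (suc k)) + x * 1-y * (B * qFactorial p (suc K) * Tk)
  ≡⟨ cong₂ (λ u v → 1-x * u + x * 1-y * v)
       (trans (invPochCoeff-qFactorial p K (suc k)) (cong (qFactorial p) (sym (ℕₚ.+-suc k K))))
       (invPochCoeff-qFactorial p (suc K) k) ⟩
    1-x * S + x * 1-y * S
  ≡⟨ solve 3 (λ x y S → (con 1ℚ :- x) :* S :+ x :* (con 1ℚ :- y) :* S := S :* (con 1ℚ :- y :* x))
       refl x y S ⟩
    S * (1ℚ - y * x)
  ≡⟨ cong (λ z → S * (1ℚ - z)) (pow-+ p (suc k) (suc K)) ⟨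
    qFactorial p (suc k ℕ.+ suc K) ∎
  where
  open ≡-Reasoning
  A = invPochCoeff 1ℚ p (suc K) (suc k)
  B = invPochCoeff 1ℚ p (suc (suc K)) k
  x = pow p (suc K)
  y = pow p (suc k)
  1-x = 1ℚ - x
  1-y = 1ℚ - y
  TK = qFactorial p K
  Tk = qFactorial p k
  S = qFactorial p (k ℕ.+ suc K)

divℚ-*-cancel : ∀ x y → y ≢ 0ℚ → divℚ x y * y ≡ x
divℚ-*-cancel x y y≢0 with y ℚₚ.≟ 0ℚ
... | yes y≡0  = contradiction y≡0 y≢0
... | no  y≢0′ = trans (ℚₚ.*-assoc x (1/ y) y)
                       (trans (cong (x *_) (ℚₚ.*-inverseˡ y)) (ℚₚ.*-identityʳ x))
  where instance _ = ≢-nonZero y≢0′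

poch-qFactorial : ∀ p a b → poch (pow p (suc a)) p b * qFactorial p a ≡ qFactorial p (a ℕ.+ b)
poch-qFactorial p a zero    =
  trans (ℚₚ.*-identityˡ (qFactorial p a)) (cong (qFactorial p) (sym (ℕₚ.+-identityʳ a)))
poch-qFactorial p a (suc b) = begin
    P * (1ℚ - pow p (suc a) * pow p b) * qFactorial p a
  ≡⟨ solve 3 (λ x y z → x :* y :* z := x :* z :* y) refl P (1ℚ - pow p (suc a) * pow p b) (qFactorial p a) ⟩
    P * qFactorial p a * (1ℚ - pow p (suc a) * pow p b)
  ≡⟨ cong₂ (λ u v → u * (1ℚ - v)) (poch-qFactorial p a b) (sym (pow-+ p (suc a) b)) ⟩
    qFactorial p (a ℕ.+ b) * (1ℚ - p * pow p (a ℕ.+ b))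
  ≡⟨ cong (qFactorial p) (ℕₚ.+-suc a b) ⟨
    qFactorial p (a ℕ.+ suc b) ∎
  where
  open ≡-Reasoning
  P = poch (pow p (suc a)) p b

qbinom-qFactorial : ∀ {p} → (∀ m → pow p (suc m) ≢ 1ℚ) → ∀ n j → j ℕ.≤ n →
  qbinom p n j * qFactorial p j * qFactorial p (n ∸ j) ≡ qFactorial p n
qbinom-qFactorial {p} p^≢1 n j j≤n with j ℕ.≤? n
... | no  j≰n = contradiction j≤n j≰n
... | yes _   = begin
    divℚ X (qFactorial p j) * qFactorial p j * qFactorial p (n ∸ j)
  ≡⟨ cong (_* qFactorial p (n ∸ j)) (divℚ-*-cancel X (qFactorial p j) (qFactorial-≢0 p^≢1 j)) ⟩
    X * qFactorial p (n ∸ j)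
  ≡⟨ poch-qFactorial p (n ∸ j) j ⟩
    qFactorial p (n ∸ j ℕ.+ j)
  ≡⟨ cong (qFactorial p) (ℕₚ.m∸n+n≡m j≤n) ⟩
    qFactorial p n ∎
  where
  open ≡-Reasoning
  X = poch (pow p (suc (n ∸ j))) p j

module _ {p : ℚ} (p^≢1 : ∀ m → pow p (suc m) ≢ 1ℚ) (K k : ℕ) where
  private
    cancel-qFactorials : ∀ {u v} →
      u * qFactorial p K * qFactorial p k ≡ v * qFactorial p K * qFactorial p k → u ≡ v
    cancel-qFactorials = *-cancelʳ-≢0 (qFactorial-≢0 p^≢1 K) ∘ *-cancelʳ-≢0 (qFactorial-≢0 p^≢1 k)

  qbinom[k+K,k]≡invPochCoeff : qbinom p (k ℕ.+ K) k ≡ invPochCoeff 1ℚ p (suc K) k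
  qbinom[k+K,k]≡invPochCoeff = cancel-qFactorials (begin
      Q * qFactorial p K * qFactorial p k
    ≡⟨ solve 3 (λ Q a b → Q :* a :* b := Q :* b :* a) refl Q (qFactorial p K) (qFactorial p k) ⟩
      Q * qFactorial p k * qFactorial p K
    ≡⟨ cong (λ n → Q * qFactorial p k * qFactorial p n) (ℕₚ.m+n∸m≡n k K) ⟨
      Q * qFactorial p k * qFactorial p (k ℕ.+ K ∸ k)
    ≡⟨ qbinom-qFactorial p^≢1 (k ℕ.+ K) k (ℕₚ.m≤m+n k K) ⟩
      qFactorial p (k ℕ.+ K)
    ≡⟨ invPochCoeff-qFactorial p K k ⟨
      invPochCoeff 1ℚ p (suc K) k * qFactorial p K * qFactorial p k ∎)
    where
    open ≡-Reasoning
    Q = qbinom p (k ℕ.+ K) k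

  qbinom[k+K,K]≡invPochCoeff : qbinom p (k ℕ.+ K) K ≡ invPochCoeff 1ℚ p (suc K) k
  qbinom[k+K,K]≡invPochCoeff = cancel-qFactorials (begin
      Q * qFactorial p K * qFactorial p k
    ≡⟨ cong (λ n → Q * qFactorial p K * qFactorial p n) (ℕₚ.m+n∸n≡m k K) ⟨
      Q * qFactorial p K * qFactorial p (k ℕ.+ K ∸ K)
    ≡⟨ qbinom-qFactorial p^≢1 (k ℕ.+ K) K (ℕₚ.m≤n+m K k) ⟩
      qFactorial p (k ℕ.+ K)
    ≡⟨ invPochCoeff-qFactorial p K k ⟨
      invPochCoeff 1ℚ p (suc K) k * qFactorial p K * qFactorial p k ∎)
    where
    open ≡-Reasoning
    Q = qbinom p (k ℕ.+ K) K

invPochCoeff≡pow*qbinom : ∀ {q} → (∀ m → pow q (suc m) ≢ 1ℚ) → ∀ c K k →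
  invPochCoeff c q (suc K) k ≡ pow c k * qbinom q (k ℕ.+ K) k
invPochCoeff≡pow*qbinom q^≢1 c K k =
  trans (invPochCoeff-scale c _ (suc K) k) (cong (pow c k *_) (sym (qbinom[k+K,k]≡invPochCoeff q^≢1 K k)))

invPochCoeff[n∸i]≡qbinom : ∀ {q} → (∀ m → pow q (suc m) ≢ 1ℚ) → ∀ K {i n} → i ℕ.≤ n →
  invPochCoeff 1ℚ q (suc K) (n ∸ i) ≡ qbinom q (K ℕ.+ n ∸ i) K
invPochCoeff[n∸i]≡qbinom {q} q^≢1 K {i} {n} i≤n = begin
    invPochCoeff 1ℚ q (suc K) (n ∸ i)   ≡⟨ qbinom[k+K,K]≡invPochCoeff q^≢1 K (n ∸ i) ⟨
    qbinom q (n ∸ i ℕ.+ K) K            ≡⟨ cong (λ m → qbinom q m K) (ℕₚ.+-comm (n ∸ i) K) ⟩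
    qbinom q (K ℕ.+ (n ∸ i)) K          ≡⟨ cong (λ m → qbinom q m K) (ℕₚ.+-∸-assoc K i≤n) ⟨
    qbinom q (K ℕ.+ n ∸ i) K            ∎
  where open ≡-Reasoning

2M+2≡[1+M]+[1+M] : ∀ M → suc (2 ℕ.* M ℕ.+ 1) ≡ suc M ℕ.+ suc M
2M+2≡[1+M]+[1+M] M = cong suc (begin
    2 ℕ.* M ℕ.+ 1            ≡⟨ ℕₚ.+-comm (2 ℕ.* M) 1 ⟩
    suc (M ℕ.+ (M ℕ.+ 0))    ≡⟨ cong (λ n → suc (M ℕ.+ n)) (ℕₚ.+-identityʳ M) ⟩
    suc (M ℕ.+ M)            ≡⟨ ℕₚ.+-suc M M ⟨
    M ℕ.+ suc M              ∎)
  where open ≡-Reasoning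

mainTheorem12 : (p : ℚ) → p ≢ 1ℚ → p ≢ - 1ℚ → (N M : ℕ) →
    qbinom p (2 ℕ.* N ℕ.+ 2 ℕ.* M ℕ.+ 1) (2 ℕ.* N)
      ≡ sumUpTo (2 ℕ.* N) (λ i →
          pow p i * qbinom (p * p) (i ℕ.+ M) i
                  * qbinom (p * p) (M ℕ.+ 2 ℕ.* N ∸ i) M)
mainTheorem12 p p≢1 p≢-1 N M = begin
    qbinom p (2 ℕ.* N ℕ.+ 2 ℕ.* M ℕ.+ 1) (2 ℕ.* N)
  ≡⟨ cong (λ n → qbinom p n (2 ℕ.* N)) (ℕₚ.+-assoc (2 ℕ.* N) (2 ℕ.* M) 1) ⟩
    qbinom p (2 ℕ.* N ℕ.+ (2 ℕ.* M ℕ.+ 1)) (2 ℕ.* N)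
  ≡⟨ qbinom[k+K,k]≡invPochCoeff p^≢1 (2 ℕ.* M ℕ.+ 1) (2 ℕ.* N) ⟩
    invPochCoeff 1ℚ p (suc (2 ℕ.* M ℕ.+ 1)) (2 ℕ.* N)
  ≡⟨ cong (λ n → invPochCoeff 1ℚ p n (2 ℕ.* N)) (2M+2≡[1+M]+[1+M] M) ⟩
    invPochCoeff 1ℚ p (suc M ℕ.+ suc M) (2 ℕ.* N)
  ≡⟨ conv-invPochCoeff-square p (suc M) (2 ℕ.* N) ⟨
    conv (invPochCoeff p q (suc M)) (invPochCoeff 1ℚ q (suc M)) (2 ℕ.* N)
  ≡⟨ sumUpTo-cong (2 ℕ.* N) (λ i i≤2N →
       cong₂ _*_ (invPochCoeff≡pow*qbinom q^≢1 p M i) (invPochCoeff[n∸i]≡qbinom q^≢1 M i≤2N)) ⟩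
    sumUpTo (2 ℕ.* N) (λ i → pow p i * qbinom q (i ℕ.+ M) i * qbinom q (M ℕ.+ 2 ℕ.* N ∸ i) M) ∎
  where
  open ≡-Reasoning
  q = p * p
  p^≢1 : ∀ m → pow p (suc m) ≢ 1ℚ
  p^≢1 = pow-suc-≢1 p≢1 p≢-1
  q^≢1 : ∀ m → pow q (suc m) ≢ 1ℚ
  q^≢1 m = p^≢1 (m ℕ.+ suc m) ∘ trans (sym (pow-square p (suc m)))
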